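{- Let $N=(V,E,r,X)$ be a DC $X$-network, and let $W$ and $W'$ be subsets of $V$ that contain neither the root $r$ nor any leaf. For a subset $U\subseteq V$ of this kind, let $N(U)$ denote the unique DC $X$-network that is a CPS of $N$, has no redundant arcs, and has vertex set $U\cup\{r\}\cup X$. Then $N(W')$ is a CPS of $N(W)$ if and only if $W'\subseteq W$.
   Context: An $X$-network $N=(V,E,r,X)$ is a finite directed graph (no loops, no multiple arcs) that is acyclic, has a root $r$ (every vertex is reachable from $r$ by a directed path), and whose leaves (vertices of out-degree $0$) are identified bijectively with $X$. The cluster of $v$ is $cl(v;N)=\{x\in X:\text{there is a directed path (possibly of length 0) from } v \text{ to } x\}$. $N$ is distinct-cluster (DC) if distinct vertices have distinct clusters; vertices of DC networks are identified with their clusters. An arc $(a,b)$ is redundant if there is a directed path from $a$ to $b$ of length greater than $1$. For a vertex $v\neq r$, $v\notin X$, with parents $q_1,\dots,q_k$ and children $c_1,\dots,c_m$, $D(v)N$ deletes $v$ and its incident arcs and adds arcs $(q_i,c_j)$ for all $i,j$ (no duplicates). For a redundant arc $(a,b)$, $D(a,b)N$ deletes that arc. A DC $X$-network $N'$ is a cluster-preserving simplification (CPS) of $N$ if there is a sequence $N=N_0,\dots,N_k=N'$ ($k\ge0$) of DC $X$-networks with each $N_{i+1}=D(v)N_i$ for a non-root non-leaf vertex $v$ of $N_i$, or $N_{i+1}=D(a,b)N_i$ for a redundant arc $(a,b)$ of $N_i$; vertices of $N'$ are identified with the vertices of $N$ having the same cluster. (The existence and uniqueness of $N(U)$ is a result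 of the paper.) -}

module Defs where

open import Data.Nat using (ℕ)
open import Data.Bool using (Bool; true; false; T; _∧_; not)
import Data.Bool as Bool
open import Data.Fin using (Fin)
open import Data.Fin.Subset using (Subset; ⊤; ⁅_⁆; _∈_)
open import Data.Vec.Properties using (≡-dec)
open import Data.Product using (Σ; ∃; _×_; _,_)
open import Data.Sum using (_⊎_)
open import Relation.Nullary using (¬_)
open import Relation.Nullary.Decidable using (⌊_⌋)
open import Relation.Binary.PropositionalEquality using (_≡_; _≢_)
open import Function.Bundles using (_⇔_)

-- Convention: X = Fin n.  Following the paper, vertices of a DC X-network
-- are identified with their clusters, so vertices are subsets of X
-- (Subset n).  A network is given by (decidable) vertex and arc predicates
-- on Subset n; the root is the vertex with cluster X (= ⊤) and the leaf
-- identified with x ∈ X is the vertex with cluster ⁅ x ⁆.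
record Net (n : ℕ) : Set where
  field
    V : Subset n → Bool
    E : Subset n → Subset n → Bool
open Net public

module _ {n : ℕ} where

  _==_ : Subset n → Subset n → Bool
  u == v = ⌊ ≡-dec Bool._≟_ u v ⌋

  Vx : Net n → Subset n → Set
  Vx N u = T (V N u)

  Arc : Net n → Subset n → Subset n → Set
  Arc N a b = T (E N a b)

  data Path (N : Net n) : Subset n → Subset n → Set where
    here : ∀ {a} → Path N a a
    step : ∀ {a b c} → Arc N a b → Path N b c → Path N a c

  Path⁺ : Net n → Subset n → Subset n → Set
  Path⁺ N a c = ∃ λ b → Arc N a b × Path N b c

  IsLeaf : Net n → Subset n → Set
  IsLeaf N v = ∀ c → ¬ Arc N v c

  InCluster : Net n → Subset n → Fin n → Set
  InCluster N v x = Path N v ⁅ x ⁆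

  -- N is a DC X-network (with vertices identified with their clusters):
  -- a finite acyclic digraph (no loops, no multiple arcs automatically,
  -- arcs being a relation), rooted at ⊤, whose leaves are exactly the
  -- vertices ⁅ x ⁆ (x ∈ X), and in which every vertex's cluster is
  -- the subset it is labelled with (hence distinct vertices have
  -- distinct clusters).
  record IsDCNet (N : Net n) : Set where
    field
      arcs-vertices : ∀ a b → Arc N a b → Vx N a × Vx N b
      acyclic       : ∀ a → ¬ Path⁺ N a a
      root-vertex   : Vx N ⊤
      rooted        : ∀ v → Vx N v → Path N ⊤ v
      leaf-vertex   : ∀ x → Vx N ⁅ x ⁆
      leaf-is-leaf  : ∀ x → IsLeaf N ⁅ x ⁆
      leaves-are-X  : ∀ v → Vx N v → IsLeaf N v → ∃ λ x → v ≡ ⁅ x ⁆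
      cluster       : ∀ v → Vx N v → ∀ x → (x ∈ v ⇔ InCluster N v x)

  _≈N_ : Net n → Net n → Set
  N ≈N M = (∀ u → V N u ≡ V M u) × (∀ a b → E N a b ≡ E M a b)

  Dv : Subset n → Net n → Net n
  Dv v N = record
    { V = λ u → V N u ∧ not (u == v)
    ; E = λ a b → not (a == v) ∧ not (b == v) ∧
                  (E N a b Bool.∨ (E N a v ∧ E N v b))
    }

  Darc : Subset n → Subset n → Net n → Net n
  Darc a b N = record
    { V = V N
    ; E = λ x y → E N x y ∧ not ((x == a) ∧ (y == b))
    }

  Redundant : Net n → Subset n → Subset n → Set
  Redundant N a b = Arc N a b × (∃ λ c → Arc N a c × Path⁺ N c b)

  NoRedundant : Net n → Set
  NoRedundant N = ∀ a b → ¬ Redundant N a b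

  Inner : Net n → Subset n → Set
  Inner N v = Vx N v × v ≢ ⊤ × ¬ IsLeaf N v

  Step : Net n → Net n → Set
  Step N M = (∃ λ v → Inner N v × M ≈N Dv v N)
           ⊎ (∃ λ a → ∃ λ b → Redundant N a b × M ≈N Darc a b N)

  data Seq : Net n → Net n → Set where
    stop : ∀ {N M} → M ≈N N → Seq N M
    next : ∀ {N M K} → Step N M → IsDCNet M → Seq M K → Seq N K

  CPS : Net n → Net n → Set
  CPS N M = IsDCNet N × IsDCNet M × Seq N M

  Admissible : Net n → (Subset n → Bool) → Set
  Admissible N U = ∀ u → T (U u) → Vx N u × u ≢ ⊤ × (∀ x → u ≢ ⁅ x ⁆)

  IsNU : Net n → (Subset n → Bool) → Net n → Set
  IsNU N U M = IsDCNet M × CPS N M × NoRedundant M ×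
               (∀ u → Vx M u ⇔ (T (U u) ⊎ u ≡ ⊤ ⊎ ∃ λ x → u ≡ ⁅ x ⁆))

-- Every simplification step deletes a vertex or an arc and keeps the reachability relation
-- among the remaining vertices, so a CPS M of N satisfies M ⊑ N: V(M) ⊆ V(N), and M-paths
-- between vertices of M are exactly the N-paths.  Hence a CPS of N(W) has no vertex outside
-- W ∪ {r} ∪ X, which gives W′ ⊆ W.  Conversely, if W′ ⊆ W then N(W′) ⊑ N, N(W) ⊑ N and
-- V(N(W′)) ⊆ V(N(W)).  Delete from N(W) the vertices missing in N(W′): they are neither root
-- nor leaves, and each deletion keeps ⊑ N.  Two networks ⊑ N with the same vertices differ
-- only by redundant arcs; since N(W′) has none, all its arcs are present, and the remaining
-- extra arcs can be deleted one at a time, ending at N(W′).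
module Submission where

open import Defs
open import Data.Nat using (ℕ; zero; suc)
open import Data.Bool using (Bool; true; false; T; _∧_; not)
import Data.Bool as Bool
open import Data.Bool.Properties using (T-∧; T-∨)
open import Data.Empty using (⊥-elim)
open import Data.Fin.Subset using (Subset; ⊤; ⁅_⁆; _∈_)
open import Data.Vec using ([]; _∷_)
open import Data.Vec.Properties using (≡-dec)
open import Data.List using (List; []; _∷_; map; _++_; cartesianProduct)
open import Data.List.Membership.Propositional using () renaming (_∈_ to _∈ˡ_)
open import Data.List.Membership.Propositional.Properties
  using (∈-map⁺; ∈-++⁺ˡ; ∈-++⁺ʳ; ∈-cartesianProduct⁺)
open import Data.List.Relation.Unary.Any using (here; there)
open import Data.Product using (∃; _×_; _,_; proj₁; proj₂)
open import Data.Product.Function.NonDependent.Propositional using (_×-⇔_)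
open import Data.Sum using (_⊎_; inj₁; inj₂; map₁)
open import Data.Sum.Function.Propositional using (_⊎-⇔_)
open import Function.Base using (_∘_)
open import Function.Bundles using (_⇔_; mk⇔; Equivalence)
open import Function.Construct.Composition using (_⇔-∘_)
open import Function.Construct.Identity using (⇔-id)
open import Function.Construct.Symmetry using (⇔-sym)
open import Relation.Binary.Definitions using (DecidableEquality)
open import Relation.Binary.Construct.Closure.ReflexiveTransitive using (Star; ε; _◅_; _◅◅_)
import Relation.Binary.Construct.Closure.ReflexiveTransitive as Star
open import Relation.Binary.PropositionalEquality using (_≡_; _≢_; refl; sym; subst)
open import Relation.Nullary using (¬_; yes; no; _×-dec_)
open import Relation.Nullary.Decidable
  using (T?; toWitness; fromWitness; toWitnessFalse; fromWitnessFalse)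

open Equivalence using (to; from)
open IsDCNet

T-injective : ∀ {x y} → (T x → T y) → (T y → T x) → x ≡ y
T-injective {false} {false} _ _ = refl
T-injective {false} {true}  _ g = ⊥-elim (g _)
T-injective {true}  {false} f _ = ⊥-elim (f _)
T-injective {true}  {true}  _ _ = refl

T-not-∧ : ∀ {x y} → T (not (x ∧ y)) ⇔ (¬ (T x × T y))
T-not-∧ {true}  {true}  = mk⇔ (λ ()) (λ h → h (_ , _))
T-not-∧ {true}  {false} = mk⇔ (λ { _ (_ , ()) }) _
T-not-∧ {false}         = mk⇔ (λ { _ (() , _) }) _

subsets : ∀ n → List (Subset n)
subsets zero    = [] ∷ []
subsets (suc n) = map (true ∷_) (subsets n) ++ map (false ∷_) (subsets n)

∈-subsets : ∀ {n} (u : Subset n) → u ∈ˡ subsets n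
∈-subsets []                  = here refl
∈-subsets (true ∷ u)          = ∈-++⁺ˡ (∈-map⁺ (true ∷_) (∈-subsets u))
∈-subsets {suc n} (false ∷ u) = ∈-++⁺ʳ (map (true ∷_) (subsets n)) (∈-map⁺ (false ∷_) (∈-subsets u))

module _ {n : ℕ} where

  _≟_ : DecidableEquality (Subset n)
  _≟_ = ≡-dec Bool._≟_

  ==⇔≡ : {u v : Subset n} → T (u == v) ⇔ u ≡ v
  ==⇔≡ {u} {v} = mk⇔ (toWitness {a? = u ≟ v}) (fromWitness {a? = u ≟ v})

  not-==⇔≢ : {u v : Subset n} → T (not (u == v)) ⇔ u ≢ v
  not-==⇔≢ {u} {v} = mk⇔ (toWitnessFalse {a? = u ≟ v}) (fromWitnessFalse {a? = u ≟ v})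

  module _ {M : Net n} where

    _++ᴾ_ : ∀ {a b c} → Path M a b → Path M b c → Path M a c
    here     ++ᴾ q = q
    step x p ++ᴾ q = step x (p ++ᴾ q)

    Path⁺⇒Path : ∀ {a b} → Path⁺ M a b → Path M a b
    Path⁺⇒Path (_ , x , p) = step x p

    Path⇒Path⁺ : ∀ {a b} → Path M a b → a ≢ b → Path⁺ M a b
    Path⇒Path⁺ here       a≢a = ⊥-elim (a≢a refl)
    Path⇒Path⁺ (step x p) _   = _ , x , p

    Path-++⁺ : ∀ {a b c} → Path M a b → Path⁺ M b c → Path⁺ M a c
    Path-++⁺ here       q = q
    Path-++⁺ (step x p) q = _ , x , (p ++ᴾ Path⁺⇒Path q)

    Path⁺-++ : ∀ {a b c} → Path⁺ M a b → Path M b c → Path⁺ M a c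
    Path⁺-++ (_ , x , p) q = _ , x , (p ++ᴾ q)

    module _ (dc : IsDCNet M) where

      no-loop : ∀ {a} → ¬ Arc M a a
      no-loop {a} x = acyclic dc a (a , x , here)

      Path⁺⇒≢ : ∀ {a b} → Path⁺ M a b → a ≢ b
      Path⁺⇒≢ {a} p refl = acyclic dc a p

      no-return : ∀ {a b} → Arc M a b → ¬ Path M b a
      no-return {a} x p = acyclic dc a (_ , x , p)

  module _ {M K : Net n} where

    Path-map : (∀ {x y} → Arc M x y → Path K x y) → ∀ {a b} → Path M a b → Path K a b
    Path-map f here       = here
    Path-map f (step x p) = f x ++ᴾ Path-map f p

    Path⁺-map : (∀ {x y} → Arc M x y → Path⁺ K x y) → ∀ {a b} → Path⁺ M a b → Path⁺ K a b
    Path⁺-map f (_ , x , p) = Path⁺-++ (f x) (Path-map (Path⁺⇒Path ∘ f) p)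

  module _ {M K : Net n} (M≈K : M ≈N K) where

    ≈-Vx : ∀ {u} → Vx M u → Vx K u
    ≈-Vx {u} = subst T (proj₁ M≈K u)

    ≈-Arc : ∀ {a b} → Arc M a b → Arc K a b
    ≈-Arc {a} {b} = subst T (proj₂ M≈K a b)

    ≈-Path : ∀ {a b} → Path M a b → Path K a b
    ≈-Path = Path-map (λ x → step (≈-Arc x) here)

  ≈-sym : {M K : Net n} → M ≈N K → K ≈N M
  ≈-sym (V≡ , E≡) = (λ u → sym (V≡ u)) , (λ a b → sym (E≡ a b))

  ≈-refl : {M : Net n} → M ≈N M
  ≈-refl = (λ _ → refl) , (λ _ _ → refl)

  _⊆ⱽ_ : Net n → Net n → Set
  M ⊆ⱽ K = ∀ {u} → Vx M u → Vx K u

  _⊆ᴬ_ : Net n → Net n → Set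
  M ⊆ᴬ K = ∀ {a b} → Arc M a b → Arc K a b

  ⊆-antisym : {M K : Net n} → M ⊆ⱽ K → K ⊆ⱽ M → M ⊆ᴬ K → K ⊆ᴬ M → M ≈N K
  ⊆-antisym V⊆ V⊇ E⊆ E⊇ = (λ _ → T-injective V⊆ V⊇) , (λ _ _ → T-injective E⊆ E⊇)

  record _⊑_ (M N : Net n) : Set where
    field
      vertices : M ⊆ⱽ N
      paths    : ∀ {u w} → Vx M u → Vx M w → Path M u w ⇔ Path N u w
  open _⊑_

  ⊑-trans : {L M N : Net n} → L ⊑ M → M ⊑ N → L ⊑ N
  ⊑-trans L⊑M M⊑N = record
    { vertices = vertices M⊑N ∘ vertices L⊑M
    ; paths    = λ u w → paths M⊑N (vertices L⊑M u) (vertices L⊑M w) ⇔-∘ paths L⊑M u w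
    }

  ≈-⊑ : {M N : Net n} → M ≈N N → M ⊑ N
  ≈-⊑ M≈N = record
    { vertices = ≈-Vx M≈N
    ; paths    = λ _ _ → mk⇔ (≈-Path M≈N) (≈-Path (≈-sym M≈N))
    }

  module _ {M N : Net n} (dc : IsDCNet N) (M⊑N : M ⊑ N) where

    ⊑-rooted : Vx M ⊤ → ∀ v → Vx M v → Path M ⊤ v
    ⊑-rooted root v v∈M = paths M⊑N root v∈M .from (rooted dc v (vertices M⊑N v∈M))

    ⊑-cluster : (∀ x → Vx M ⁅ x ⁆) → ∀ v → Vx M v → ∀ x → (x ∈ v ⇔ InCluster M v x)
    ⊑-cluster leaf v v∈M x = ⇔-sym (paths M⊑N v∈M (leaf x)) ⇔-∘ cluster dc v (vertices M⊑N v∈M) x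

  module _ {N : Net n} {v : Subset n} where

    Vx-Dv : ∀ {u} → Vx (Dv v N) u ⇔ (Vx N u × u ≢ v)
    Vx-Dv {u} = (⇔-id _ ×-⇔ not-==⇔≢) ⇔-∘ T-∧ {V N u}

    Arc-Dv : ∀ {a b} → Arc (Dv v N) a b ⇔ (a ≢ v × b ≢ v × (Arc N a b ⊎ Arc N a v × Arc N v b))
    Arc-Dv {a} {b} =
      (not-==⇔≢ ×-⇔ (not-==⇔≢ ×-⇔ (⇔-id _ ⊎-⇔ T-∧ {E N a v}) ⇔-∘ T-∨ {E N a b})
                    ⇔-∘ T-∧ {not (b == v)})
      ⇔-∘ T-∧ {not (a == v)}

    Arc-Dv⇒Path⁺ : ∀ {a b} → Arc (Dv v N) a b → Path⁺ N a b
    Arc-Dv⇒Path⁺ x with Arc-Dv .to x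
    ... | _ , _ , inj₁ ab        = _ , ab , here
    ... | _ , _ , inj₂ (av , vb) = _ , av , step vb here

    Path-Dv⁻ : ∀ {a b} → Path (Dv v N) a b → Path N a b
    Path-Dv⁻ = Path-map (Path⁺⇒Path ∘ Arc-Dv⇒Path⁺)

    Path-Dv⁺ : IsDCNet N → ∀ {a b} → a ≢ v → b ≢ v → Path N a b → Path (Dv v N) a b
    Path-Dv⁺ dc a≢v b≢v here = here
    Path-Dv⁺ dc a≢v b≢v (step {b = c} ac p) with c ≟ v
    ... | no c≢v = step (Arc-Dv .from (a≢v , c≢v , inj₁ ac)) (Path-Dv⁺ dc c≢v b≢v p)
    Path-Dv⁺ dc a≢v b≢v (step ac here)                | yes refl = ⊥-elim (b≢v refl)
    Path-Dv⁺ dc a≢v b≢v (step av (step {b = d} vd p)) | yes refl =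
      step (Arc-Dv .from (a≢v , d≢v , inj₂ (av , vd))) (Path-Dv⁺ dc d≢v b≢v p)
      where
        d≢v : d ≢ v
        d≢v refl = no-loop dc vd

    Dv-⊑ : IsDCNet N → Dv v N ⊑ N
    Dv-⊑ dc = record
      { vertices = proj₁ ∘ Vx-Dv .to
      ; paths    = λ u w → mk⇔ Path-Dv⁻ (Path-Dv⁺ dc (proj₂ (Vx-Dv .to u)) (proj₂ (Vx-Dv .to w)))
      }

    Dv-leaf⇒leaf : IsDCNet N → ¬ IsLeaf N v → ∀ {u} → u ≢ v → IsLeaf (Dv v N) u → IsLeaf N u
    Dv-leaf⇒leaf dc v-inner {u} u≢v u-leaf c uc with c ≟ v
    ... | no c≢v  = u-leaf c (Arc-Dv .from (u≢v , c≢v , inj₁ uc))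
    ... | yes refl = v-inner λ d vd →
      u-leaf d (Arc-Dv .from (u≢v , (λ { refl → no-loop dc vd }) , inj₂ (uc , vd)))

    Dv-isDCNet : IsDCNet N → Inner N v → IsDCNet (Dv v N)
    Dv-isDCNet dc (_ , v≢⊤ , v-inner) = record
      { arcs-vertices = arcs-vertices′
      ; acyclic       = λ a p → acyclic dc a (Path⁺-map Arc-Dv⇒Path⁺ p)
      ; root-vertex   = root
      ; rooted        = ⊑-rooted dc (Dv-⊑ dc) root
      ; leaf-vertex   = leaf
      ; leaf-is-leaf  = λ x c xc → leaf-is-leaf dc x _ (proj₁ (proj₂ (Arc-Dv⇒Path⁺ xc)))
      ; leaves-are-X  = λ u u∈D u-leaf →
          let u∈N , u≢v = Vx-Dv .to u∈D in leaves-are-X dc u u∈N (Dv-leaf⇒leaf dc v-inner u≢v u-leaf)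
      ; cluster       = ⊑-cluster dc (Dv-⊑ dc) leaf
      }
      where
        root : Vx (Dv v N) ⊤
        root = Vx-Dv .from (root-vertex dc , λ ⊤≡v → v≢⊤ (sym ⊤≡v))

        leaf : ∀ x → Vx (Dv v N) ⁅ x ⁆
        leaf x = Vx-Dv .from (leaf-vertex dc x , λ { refl → v-inner (leaf-is-leaf dc x) })

        arcs-vertices′ : ∀ a b → Arc (Dv v N) a b → Vx (Dv v N) a × Vx (Dv v N) b
        arcs-vertices′ a b ab with Arc-Dv .to ab
        ... | a≢v , b≢v , inj₁ ab′ = Vx-Dv .from (proj₁ (arcs-vertices dc a b ab′) , a≢v)
                                   , Vx-Dv .from (proj₂ (arcs-vertices dc a b ab′) , b≢v)
        ... | a≢v , b≢v , inj₂ (av , vb) = Vx-Dv .from (proj₁ (arcs-vertices dc a v av) , a≢v)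
                                         , Vx-Dv .from (proj₂ (arcs-vertices dc v b vb) , b≢v)

  module _ {N : Net n} {a b : Subset n} where

    Arc-Darc : ∀ {x y} → Arc (Darc a b N) x y ⇔ (Arc N x y × ¬ (x ≡ a × y ≡ b))
    Arc-Darc {x} {y} = (⇔-id _ ×-⇔ not-both) ⇔-∘ T-∧ {E N x y}
      where
        not-both : T (not ((x == a) ∧ (y == b))) ⇔ (¬ (x ≡ a × y ≡ b))
        not-both = mk⇔ (λ t (x≡a , y≡b) → T-not-∧ .to t (==⇔≡ .from x≡a , ==⇔≡ .from y≡b))
                       (λ ne → T-not-∧ .from λ (x=a , y=b) → ne (==⇔≡ .to x=a , ==⇔≡ .to y=b))

    Arc-Darc⁻ : ∀ {x y} → Arc (Darc a b N) x y → Arc N x y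
    Arc-Darc⁻ = proj₁ ∘ Arc-Darc .to

    Path-Darc⁻ : ∀ {s t} → Path (Darc a b N) s t → Path N s t
    Path-Darc⁻ = Path-map (λ xy → step (Arc-Darc⁻ xy) here)

    Path-Darc-avoiding : ∀ {s t} → ¬ Path N s a → Path N s t → Path (Darc a b N) s t
    Path-Darc-avoiding s↛a here       = here
    Path-Darc-avoiding s↛a (step sy p) =
      step (Arc-Darc .from (sy , λ { (refl , _) → s↛a here }))
           (Path-Darc-avoiding (s↛a ∘ step sy) p)

    -- The detour a → c ⇝ b cannot use the arc (a , b), since it never returns to a.
    Redundant⇒Darc-Path⁺ : IsDCNet N → Redundant N a b → Path⁺ (Darc a b N) a b
    Redundant⇒Darc-Path⁺ dc (_ , c , ac , c⇝b) =
      c , Arc-Darc .from (ac , λ (_ , c≡b) → Path⁺⇒≢ dc c⇝b c≡b)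
        , Path-Darc-avoiding (no-return dc ac) (Path⁺⇒Path c⇝b)

    Path-Darc⁺ : IsDCNet N → Redundant N a b → ∀ {s t} → Path N s t → Path (Darc a b N) s t
    Path-Darc⁺ dc red here = here
    Path-Darc⁺ dc red (step {a = s} {b = y} sy p) with (s ≟ a) ×-dec (y ≟ b)
    ... | yes (refl , refl) = Path⁺⇒Path (Redundant⇒Darc-Path⁺ dc red) ++ᴾ Path-Darc⁺ dc red p
    ... | no ne             = step (Arc-Darc .from (sy , ne)) (Path-Darc⁺ dc red p)

    Darc-⊑ : IsDCNet N → Redundant N a b → Darc a b N ⊑ N
    Darc-⊑ dc red = record
      { vertices = λ u∈N → u∈N
      ; paths    = λ _ _ → mk⇔ Path-Darc⁻ (Path-Darc⁺ dc red)
      }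

    Darc-leaf⇒leaf : IsDCNet N → Redundant N a b → ∀ {u} → IsLeaf (Darc a b N) u → IsLeaf N u
    Darc-leaf⇒leaf dc red {u} u-leaf c uc with (u ≟ a) ×-dec (c ≟ b)
    ... | yes (refl , refl) = let _ , ac , _ = Redundant⇒Darc-Path⁺ dc red in u-leaf _ ac
    ... | no ne             = u-leaf c (Arc-Darc .from (uc , ne))

    Darc-isDCNet : IsDCNet N → Redundant N a b → IsDCNet (Darc a b N)
    Darc-isDCNet dc red = record
      { arcs-vertices = λ x y xy → arcs-vertices dc x y (Arc-Darc⁻ xy)
      ; acyclic       = λ x p → acyclic dc x (Path⁺-map (λ xy → _ , Arc-Darc⁻ xy , here) p)
      ; root-vertex   = root-vertex dc
      ; rooted        = ⊑-rooted dc (Darc-⊑ dc red) (root-vertex dc)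
      ; leaf-vertex   = leaf-vertex dc
      ; leaf-is-leaf  = λ x c xc → leaf-is-leaf dc x c (Arc-Darc⁻ xc)
      ; leaves-are-X  = λ u u∈N u-leaf → leaves-are-X dc u u∈N (Darc-leaf⇒leaf dc red u-leaf)
      ; cluster       = ⊑-cluster dc (Darc-⊑ dc red) (leaf-vertex dc)
      }

  Step-⊆ⱽ : {N M : Net n} → Step N M → M ⊆ⱽ N
  Step-⊆ⱽ {N} (inj₁ (v , _ , M≈D)) = proj₁ ∘ Vx-Dv {N} {v} .to ∘ ≈-Vx M≈D
  Step-⊆ⱽ (inj₂ (_ , _ , _ , M≈D)) = ≈-Vx M≈D

  Step-⊑ : {N M : Net n} → IsDCNet N → Step N M → M ⊑ N
  Step-⊑ dc (inj₁ (_ , _ , M≈D))       = ⊑-trans (≈-⊑ M≈D) (Dv-⊑ dc)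
  Step-⊑ dc (inj₂ (_ , _ , red , M≈D)) = ⊑-trans (≈-⊑ M≈D) (Darc-⊑ dc red)

  Seq-⊑ : {N M : Net n} → IsDCNet N → Seq N M → M ⊑ N
  Seq-⊑ dc (stop M≈N)        = ≈-⊑ M≈N
  Seq-⊑ dc (next st dcK seq) = ⊑-trans (Seq-⊑ dcK seq) (Step-⊑ dc st)

  CPS-⊑ : {N M : Net n} → CPS N M → M ⊑ N
  CPS-⊑ (dc , _ , seq) = Seq-⊑ dc seq

  ⊑-Path-transfer : {N M K : Net n} → M ⊑ N → K ⊑ N → M ⊆ⱽ K →
                    ∀ {u w} → Vx M u → Vx M w → Path M u w → Path K u w
  ⊑-Path-transfer M⊑N K⊑N M⊆K u w p = paths K⊑N (M⊆K u) (M⊆K w) .from (paths M⊑N u w .to p)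

  -- In K the arc (a , b) of M is replaced by a path a → d ⇝ b with d ≢ b; both pieces
  -- are paths of positive length that transfer back to M.
  missing-arc-redundant : {N M K : Net n} → M ⊑ N → K ⊑ N → IsDCNet M → IsDCNet K →
                          M ⊆ⱽ K → K ⊆ⱽ M → ∀ {a b} → Arc M a b → ¬ Arc K a b → Redundant M a b
  missing-arc-redundant {M = M} {K} M⊑N K⊑N dcM dcK M⊆K K⊆M {a} {b} ab ab∉K =
    let a∈M , b∈M    = arcs-vertices dcM a b ab
        d , ad , d⇝b = Path⇒Path⁺ (⊑-Path-transfer M⊑N K⊑N M⊆K a∈M b∈M (step ab here))
                                  (Path⁺⇒≢ dcM (b , ab , here))
        d∈K          = proj₂ (arcs-vertices dcK a d ad)
        c , ac , c⇝d = Path⇒Path⁺ (to-M (M⊆K a∈M) d∈K (step ad here)) (Path⁺⇒≢ dcK (d , ad , here))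
    in ab , c , ac , Path-++⁺ c⇝d (Path⇒Path⁺ (to-M d∈K (M⊆K b∈M) d⇝b)
                                               λ d≡b → ab∉K (subst (Arc K a) d≡b ad))
    where
      to-M : ∀ {u w} → Vx K u → Vx K w → Path K u w → Path M u w
      to-M = ⊑-Path-transfer K⊑N M⊑N K⊆M

  _⟶_ : Net n → Net n → Set
  N ⟶ M = Step N M × IsDCNet M

  _⟶ᵃ_ : Net n → Net n → Set
  N ⟶ᵃ M = (∃ λ a → ∃ λ b → Redundant N a b × M ≈N Darc a b N) × IsDCNet M

  ⟶ᵃ-⊆ᴬ : {N M : Net n} → N ⟶ᵃ M → M ⊆ᴬ N
  ⟶ᵃ-⊆ᴬ {N} ((a , b , _ , M≈D) , _) = Arc-Darc⁻ {N} {a} {b} ∘ ≈-Arc M≈D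

  ⟶ᵃ⇒⟶ : {N M : Net n} → N ⟶ᵃ M → N ⟶ M
  ⟶ᵃ⇒⟶ (del , dc) = inj₂ del , dc

  Star⇒Seq : {N M K : Net n} → Star _⟶_ N M → K ≈N M → Seq N K
  Star⇒Seq ε                K≈M = stop K≈M
  Star⇒Seq ((st , dc) ◅ st*) K≈M = next st dc (Star⇒Seq st* K≈M)

  module _ {A : Set} {R : Net n → Net n → Set} (I : Net n → Set) (G : A → Net n → Set)
           (G-stable : ∀ {x S S′} → R S S′ → G x S → G x S′)
           (establish : ∀ x {S} → I S → ∃ λ S′ → Star R S S′ × I S′ × G x S′) where

    G-stable* : ∀ {x S S′} → Star R S S′ → G x S → G x S′
    G-stable* ε         g = g
    G-stable* (r ◅ r*) g = G-stable* r* (G-stable r g)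

    establish-all : ∀ xs {S} → I S → ∃ λ F → Star R S F × I F × (∀ {x} → x ∈ˡ xs → G x F)
    establish-all []       {S} i = S , ε , i , λ ()
    establish-all (x ∷ xs)     i =
      let S′ , S⇝S′ , i′ , g  = establish x i
          F  , S′⇝F , iF , gs = establish-all xs i′
      in F , S⇝S′ ◅◅ S′⇝F , iF , λ { (here refl) → G-stable* S′⇝F g ; (there x∈xs) → gs x∈xs }

  -- The root and the leaves belong to every DC network.
  absent-vertex-inner : {S T′ : Net n} → IsDCNet S → IsDCNet T′ →
                        ∀ {u} → Vx S u → ¬ Vx T′ u → Inner S u
  absent-vertex-inner {T′ = T′} dcS dcT {u} u∈S u∉T =
    u∈S , (λ { refl → u∉T (root-vertex dcT) }) , λ u-leaf →
      let x , u≡x = leaves-are-X dcS u u∈S u-leaf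
      in u∉T (subst (Vx T′) (sym u≡x) (leaf-vertex dcT x))

  module _ {N T′ : Net n} (dcT : IsDCNet T′) (T′⊑N : T′ ⊑ N) where

    VertexInvariant : Net n → Set
    VertexInvariant S = IsDCNet S × S ⊑ N × T′ ⊆ⱽ S

    ArcInvariant : Net n → Set
    ArcInvariant S = IsDCNet S × S ⊑ N × S ⊆ⱽ T′ × T′ ⊆ⱽ S × T′ ⊆ᴬ S

    VertexSettled : Subset n → Net n → Set
    VertexSettled u S = Vx S u → Vx T′ u

    ArcSettled : Subset n × Subset n → Net n → Set
    ArcSettled (a , b) S = Arc S a b → Arc T′ a b

    delete-if-absent-vertex : ∀ u {S} → VertexInvariant S →
                              ∃ λ S′ → Star _⟶_ S S′ × VertexInvariant S′ × VertexSettled u S′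
    delete-if-absent-vertex u {S} inv@(dcS , S⊑N , T′⊆S) with T? (V S u) | T? (V T′ u)
    ... | no u∉S   | _        = S , ε , inv , ⊥-elim ∘ u∉S
    ... | yes _    | yes u∈T′ = S , ε , inv , λ _ → u∈T′
    ... | yes u∈S  | no u∉T′  =
      Dv u S , (inj₁ (u , inner , ≈-refl) , dcD) ◅ ε , (dcD , ⊑-trans (Dv-⊑ dcS) S⊑N , T′⊆D)
             , λ u∈D → ⊥-elim (proj₂ (Vx-Dv {S} {u} .to u∈D) refl)
      where
        inner : Inner S u
        inner = absent-vertex-inner dcS dcT u∈S u∉T′

        dcD : IsDCNet (Dv u S)
        dcD = Dv-isDCNet dcS inner

        T′⊆D : T′ ⊆ⱽ Dv u S
        T′⊆D w∈T′ = Vx-Dv {S} {u} .from (T′⊆S w∈T′ , λ { refl → u∉T′ w∈T′ })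

    delete-if-absent-arc : ∀ ab {S} → ArcInvariant S →
                           ∃ λ S′ → Star _⟶ᵃ_ S S′ × ArcInvariant S′ × ArcSettled ab S′
    delete-if-absent-arc (a , b) {S} inv@(dcS , S⊑N , S⊆T′ , T′⊆S , T′⊆ᴬS)
      with T? (E S a b) | T? (E T′ a b)
    ... | no ab∉S  | _         = S , ε , inv , ⊥-elim ∘ ab∉S
    ... | yes _    | yes ab∈T′ = S , ε , inv , λ _ → ab∈T′
    ... | yes ab∈S | no ab∉T′  =
      Darc a b S , ((a , b , red , ≈-refl) , dcD) ◅ ε
                 , (dcD , ⊑-trans (Darc-⊑ dcS red) S⊑N , S⊆T′ , T′⊆S , T′⊆ᴬD)
                 , λ ab∈D → ⊥-elim (proj₂ (Arc-Darc {S} {a} {b} .to ab∈D) (refl , refl))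
      where
        red : Redundant S a b
        red = missing-arc-redundant S⊑N T′⊑N dcS dcT S⊆T′ T′⊆S ab∈S ab∉T′

        dcD : IsDCNet (Darc a b S)
        dcD = Darc-isDCNet dcS red

        T′⊆ᴬD : T′ ⊆ᴬ Darc a b S
        T′⊆ᴬD xy∈T′ = Arc-Darc {S} {a} {b} .from (T′⊆ᴬS xy∈T′ , λ { (refl , refl) → ab∉T′ xy∈T′ })

    irredundant-arcs-kept : NoRedundant T′ → ∀ {F} → IsDCNet F → F ⊑ N → F ⊆ⱽ T′ → T′ ⊆ⱽ F → T′ ⊆ᴬ F
    irredundant-arcs-kept T′-irred {F} dcF F⊑N F⊆T′ T′⊆F {a} {b} ab∈T′ with T? (E F a b)
    ... | yes ab∈F = ab∈F
    ... | no ab∉F  =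
      ⊥-elim (T′-irred a b (missing-arc-redundant T′⊑N F⊑N dcT dcF T′⊆F F⊆T′ ab∈T′ ab∉F))

    delete-absent-vertices : NoRedundant T′ → ∀ {S} → VertexInvariant S →
                             ∃ λ F → Star _⟶_ S F × ArcInvariant F
    delete-absent-vertices T′-irred inv =
      let F , S⇝F , (dcF , F⊑N , T′⊆F) , settled =
            establish-all VertexInvariant VertexSettled (λ (st , _) → _∘ Step-⊆ⱽ st)
                          delete-if-absent-vertex (subsets n) inv
          F⊆T′ : F ⊆ⱽ T′
          F⊆T′ {u} = settled (∈-subsets u)
      in F , S⇝F , (dcF , F⊑N , F⊆T′ , T′⊆F , irredundant-arcs-kept T′-irred dcF F⊑N F⊆T′ T′⊆F)

    delete-absent-arcs : ∀ {S} → ArcInvariant S → ∃ λ F → Star _⟶ᵃ_ S F × T′ ≈N F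
    delete-absent-arcs inv =
      let F , S⇝F , (_ , _ , F⊆T′ , T′⊆F , T′⊆ᴬF) , settled =
            establish-all ArcInvariant ArcSettled (λ st → _∘ ⟶ᵃ-⊆ᴬ st)
                          delete-if-absent-arc (cartesianProduct (subsets n) (subsets n)) inv
          F⊆ᴬT′ : F ⊆ᴬ T′
          F⊆ᴬT′ {a} {b} = settled (∈-cartesianProduct⁺ (∈-subsets a) (∈-subsets b))
      in F , S⇝F , ⊆-antisym T′⊆F F⊆T′ T′⊆ᴬF F⊆ᴬT′

  simplifies-to : {N S T′ : Net n} → IsDCNet S → S ⊑ N → IsDCNet T′ → T′ ⊑ N → NoRedundant T′ →
                  T′ ⊆ⱽ S → Seq S T′
  simplifies-to dcS S⊑N dcT T′⊑N T′-irred T′⊆S =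
    let F , S⇝F , inv  = delete-absent-vertices dcT T′⊑N T′-irred (dcS , S⊑N , T′⊆S)
        G , F⇝G , T′≈G = delete-absent-arcs dcT T′⊑N inv
    in Star⇒Seq (S⇝F ◅◅ Star.map ⟶ᵃ⇒⟶ F⇝G) T′≈G

  module _ {N M : Net n} {U : Subset n → Bool} (M-spec : IsNU N U M) where

    private
      vertices-of-NU : ∀ u → Vx M u ⇔ (T (U u) ⊎ u ≡ ⊤ ⊎ ∃ λ x → u ≡ ⁅ x ⁆)
      vertices-of-NU = proj₂ (proj₂ (proj₂ M-spec))

    U⊆NU : ∀ {u} → T (U u) → Vx M u
    U⊆NU {u} = vertices-of-NU u .from ∘ inj₁

    NU-vertex∈U : ∀ {u} → Vx M u → u ≢ ⊤ → (∀ x → u ≢ ⁅ x ⁆) → T (U u)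
    NU-vertex∈U {u} u∈M u≢⊤ u∉X with vertices-of-NU u .to u∈M
    ... | inj₁ u∈U              = u∈U
    ... | inj₂ (inj₁ u≡⊤)       = ⊥-elim (u≢⊤ u≡⊤)
    ... | inj₂ (inj₂ (x , u≡x)) = ⊥-elim (u∉X x u≡x)

    NU-mono : ∀ {U′ M′} → IsNU N U′ M′ → (∀ u → T (U′ u) → T (U u)) → M′ ⊆ⱽ M
    NU-mono (_ , _ , _ , vertices-of-NU′) U′⊆U {u} u∈M′ =
      vertices-of-NU u .from (map₁ (U′⊆U u) (vertices-of-NU′ u .to u∈M′))

theorem7p4 : ∀ {n : ℕ} (N : Net n) → IsDCNet N →
    (W W′ : Subset n → Bool) → Admissible N W → Admissible N W′ →
    (NW NW′ : Net n) → IsNU N W NW → IsNU N W′ NW′ →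
    (CPS NW NW′ ⇔ (∀ u → T (W′ u) → T (W u)))
theorem7p4 N _ W W′ _ W′-admissible NW NW′
           NW-spec@(dcNW , cpsNW , _) NW′-spec@(dcNW′ , cpsNW′ , NW′-irred , _) =
  mk⇔ W′⊆W CPS-of-NW
  where
    W′⊆W : CPS NW NW′ → ∀ u → T (W′ u) → T (W u)
    W′⊆W cps u u∈W′ =
      let _ , u≢⊤ , u∉X = W′-admissible u u∈W′
      in NU-vertex∈U NW-spec (_⊑_.vertices (CPS-⊑ cps) (U⊆NU NW′-spec u∈W′)) u≢⊤ u∉X

    CPS-of-NW : (∀ u → T (W′ u) → T (W u)) → CPS NW NW′
    CPS-of-NW W′⊆W = dcNW , dcNW′ , simplifies-to dcNW (CPS-⊑ cpsNW) dcNW′ (CPS-⊑ cpsNW′) NW′-irred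
                                                   (NU-mono NW-spec NW′-spec W′⊆W)
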